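{- For every integer $n\geqslant 10$, $\phi(H_n,2)=9(n-15)$.
   Context: All graphs are finite, simple and undirected; $\phi(G,\lambda)=\det(\lambda I-A(G))$ is the characteristic polynomial of the adjacency matrix, and $\phi(G,2)$ its value at $\lambda=2$. For $r\geqslant 2$, $P_r$ is the path with vertices $0,\dots,r-1$ (consecutive integers adjacent); for $0<m_1<m_2<r-1$ and positive $n_1,n_2$, $P_{n_1,n_2;r}^{m_1,m_2}$ is obtained from $P_r$ by attaching at vertex $m_i$ a pendant path with $n_i$ edges; $H_n:=P_{2,2;n-4}^{2,n-7}$ for $n\geqslant 10$. -}

module Defs where

open import Data.Nat as ℕ using (ℕ; zero; suc; _∸_)
open import Data.Bool using (Bool; true; false; _∧_; _∨_; if_then_else_)
open import Data.Fin using (Fin; toℕ; punchIn) renaming (zero to fzero; suc to fsuc)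
open import Data.Integer as ℤ using (ℤ; +_; -_)

_==_ : ℕ → ℕ → Bool
m == n = Relation.Nullary.Decidable.⌊ m ℕ.≟ n ⌋
  where import Relation.Nullary.Decidable

_<ᵇ_ : ℕ → ℕ → Bool
m <ᵇ n = Relation.Nullary.Decidable.⌊ m ℕ.<? n ⌋
  where import Relation.Nullary.Decidable

-- A finite simple graph on vertex set Fin n, given by a symmetric,
-- irreflexive Boolean adjacency relation.
record Graph : Set where
  field
    size : ℕ
    adj  : Fin size → Fin size → Bool

sumFin : (n : ℕ) → (Fin n → ℤ) → ℤ
sumFin zero    f = + 0
sumFin (suc n) f = f fzero ℤ.+ sumFin n (λ i → f (fsuc i))

sign : ℕ → ℤ
sign zero          = + 1
sign (suc zero)    = - (+ 1)
sign (suc (suc k)) = sign k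

det : (n : ℕ) → (Fin n → Fin n → ℤ) → ℤ
det zero    M = + 1
det (suc n) M =
  sumFin (suc n) (λ j → sign (toℕ j) ℤ.* M fzero j ℤ.*
                         det n (λ i k → M (fsuc i) (punchIn j k)))

adjMatrix : (G : Graph) → Fin (Graph.size G) → Fin (Graph.size G) → ℤ
adjMatrix G i j = if Graph.adj G i j then + 1 else + 0

idMatrix : (n : ℕ) → Fin n → Fin n → ℤ
idMatrix n i j = if toℕ i == toℕ j then + 1 else + 0

charPolyAt : Graph → ℤ → ℤ
charPolyAt G x =
  det (Graph.size G) (λ i j → x ℤ.* idMatrix (Graph.size G) i j ℤ.- adjMatrix G i j)

-- P_{n1,n2;r}^{m1,m2}: vertices 0..r-1 form the path P_r; vertices
-- r..r+n1-1 form the pendant path (n1 edges) attached at m1 (edges m1–r,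
-- r–(r+1), ...); vertices r+n1..r+n1+n2-1 form the pendant path (n2 edges)
-- attached at m2.
-- Directed edge relation (each undirected edge listed once):
edgeP : (n1 n2 r m1 m2 : ℕ) → ℕ → ℕ → Bool
edgeP n1 n2 r m1 m2 u v =
     (suc u == v ∧ v <ᵇ r)
  ∨ (u == m1 ∧ v == r)
  ∨ ((r ∸ 1) <ᵇ u ∧ suc u == v ∧ v <ᵇ (r ℕ.+ n1))
  ∨ (u == m2 ∧ v == (r ℕ.+ n1))
  ∨ ((r ℕ.+ n1 ∸ 1) <ᵇ u ∧ suc u == v ∧ v <ᵇ (r ℕ.+ n1 ℕ.+ n2))

P : (n1 n2 r m1 m2 : ℕ) → Graph
P n1 n2 r m1 m2 = record
  { size = r ℕ.+ n1 ℕ.+ n2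
  ; adj  = λ i j → edgeP n1 n2 r m1 m2 (toℕ i) (toℕ j) ∨ edgeP n1 n2 r m1 m2 (toℕ j) (toℕ i)
  }

H : ℕ → Graph
H n = P 2 2 (n ∸ 4) 2 (n ∸ 7)

-- Write n = 10 + t. Then H_n is the path 0 - ⋯ - 5+t with the pendant paths 6+t - 7+t at 2 and
-- 8+t - 9+t at 3+t. Expanding det(2I - A) at a pendant path X - Y attached at u gives
-- φ(G, 2) = 3 φ(G - X - Y, 2) - 2 φ(G - X - Y - u, 2). Removing both pendant paths this way leaves
-- four induced subgraphs of the path P_(6+t), namely P_(6+t), P_2 ∪ P_(3+t), P_(3+t) ∪ P_2 and
-- P_2 ∪ P_t ∪ P_2, and φ(P_k, 2) = k + 1. Hence
-- φ(H_n, 2) = 3 (3 (7+t) - 6 (4+t)) - 2 (9 (4+t) - 18 (1+t)) = 9 (t - 5) = 9 (n - 15).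

module Submission where

open import Defs
open import Data.Bool using (Bool; true; false; T; if_then_else_; _∧_; _∨_)
open import Data.Bool.Properties using (T-∨; T-∧; ∨-zeroʳ)
open import Data.Empty using (⊥-elim)
open import Data.Fin using (Fin; toℕ; punchIn; fromℕ<) renaming (zero to fzero; suc to fsuc)
open import Data.Fin.Properties
  using (punchInᵢ≢i; punchIn-injective; toℕ<n; toℕ-fromℕ<; toℕ-injective)
  renaming (suc-injective to fsuc-injective; _≟_ to _≟ᶠ_)
open import Data.Integer using (ℤ; +_; -_; _+_; _*_; _-_)
import Data.Integer.Properties as ℤP
open import Data.Integer.Tactic.RingSolver using (solve-∀)
open import Data.Nat as ℕ using (ℕ; zero; suc; _<_; _≤_; _∸_; s≤s; z≤n)
import Data.Nat.Properties as ℕP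
open import Data.Product using (_×_; _,_; proj₁; proj₂)
import Data.Product as Product
open import Data.Sum using (_⊎_; inj₁; inj₂; reduce)
import Data.Sum as Sum
open import Function using (_∘_; _⇔_; Equivalence; mk⇔)
open import Relation.Nullary using (¬_; yes; no)
open import Relation.Nullary.Decidable using (fromWitness; toWitness)
open import Relation.Binary.PropositionalEquality

-- Cofactor expansion

Matrix : ℕ → Set
Matrix n = Fin n → Fin n → ℤ

minor : ∀ {n} → Fin (suc n) → Fin (suc n) → Matrix (suc n) → Matrix n
minor i j M a b = M (punchIn i a) (punchIn j b)

sumFin-cong : ∀ n {f g : Fin n → ℤ} → (∀ i → f i ≡ g i) → sumFin n f ≡ sumFin n g
sumFin-cong zero    f≗g = refl
sumFin-cong (suc n) f≗g = cong₂ _+_ (f≗g fzero) (sumFin-cong n (f≗g ∘ fsuc))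

sumFin-zero : ∀ n {f : Fin n → ℤ} → (∀ i → f i ≡ + 0) → sumFin n f ≡ + 0
sumFin-zero zero    f≗0 = refl
sumFin-zero (suc n) f≗0 = cong₂ _+_ (f≗0 fzero) (sumFin-zero n (f≗0 ∘ fsuc))

sumFin-distrib-+ : ∀ n (f g : Fin n → ℤ) →
                   sumFin n (λ i → f i + g i) ≡ sumFin n f + sumFin n g
sumFin-distrib-+ zero    f g = refl
sumFin-distrib-+ (suc n) f g
  rewrite sumFin-distrib-+ n (f ∘ fsuc) (g ∘ fsuc) =
    interchange (f fzero) (g fzero) (sumFin n (f ∘ fsuc)) (sumFin n (g ∘ fsuc))
  where
  interchange : ∀ a b c d → (a + b) + (c + d) ≡ (a + c) + (b + d)
  interchange = solve-∀

sumFin-*ˡ : ∀ n a (f : Fin n → ℤ) → sumFin n (λ i → a * f i) ≡ a * sumFin n f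
sumFin-*ˡ zero    a f = sym (ℤP.*-zeroʳ a)
sumFin-*ˡ (suc n) a f
  rewrite sumFin-*ˡ n a (f ∘ fsuc) = sym (ℤP.*-distribˡ-+ a _ _)

sumFin-punchIn : ∀ n (f : Fin (suc n) → ℤ) c →
                 sumFin (suc n) f ≡ f c + sumFin n (f ∘ punchIn c)
sumFin-punchIn n       f fzero    = refl
sumFin-punchIn (suc n) f (fsuc c)
  rewrite sumFin-punchIn n (f ∘ fsuc) c =
    swap (f fzero) (f (fsuc c)) (sumFin n (f ∘ fsuc ∘ punchIn c))
  where
  swap : ∀ a b c → a + (b + c) ≡ b + (a + c)
  swap = solve-∀

sign-suc : ∀ k → sign (suc k) ≡ - sign k
sign-suc zero          = refl
sign-suc (suc zero)    = refl
sign-suc (suc (suc k)) = sign-suc k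

sign-+ : ∀ a b → sign (a ℕ.+ b) ≡ sign a * sign b
sign-+ zero    b = sym (ℤP.*-identityˡ (sign b))
sign-+ (suc a) b
  rewrite sign-suc (a ℕ.+ b) | sign-suc a | sign-+ a b = ℤP.neg-distribˡ-* (sign a) (sign b)

sign-*-self : ∀ a → sign a * sign a ≡ + 1
sign-*-self zero          = refl
sign-*-self (suc zero)    = refl
sign-*-self (suc (suc a)) = sign-*-self a

det-cong : ∀ n {M N : Matrix n} → (∀ i j → M i j ≡ N i j) → det n M ≡ det n N
det-cong zero    M≗N = refl
det-cong (suc n) M≗N = sumFin-cong (suc n) λ j →
  cong₂ (λ x y → sign (toℕ j) * x * y) (M≗N fzero j)
        (det-cong n (λ a b → M≗N (fsuc a) (punchIn j b)))

laplaceTerm : ∀ n → Matrix (suc n) → Fin (suc n) → ℤ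
laplaceTerm n M j = sign (toℕ j) * M fzero j * det n (minor fzero j M)

laplaceTerm-zero : ∀ n (M : Matrix (suc n)) j → M fzero j ≡ + 0 → laplaceTerm n M j ≡ + 0
laplaceTerm-zero n M j M₀ⱼ≡0 rewrite M₀ⱼ≡0 | ℤP.*-zeroʳ (sign (toℕ j)) = refl

laplaceTerm-zeroMinor : ∀ n (M : Matrix (suc n)) j → det n (minor fzero j M) ≡ + 0 →
                        laplaceTerm n M j ≡ + 0
laplaceTerm-zeroMinor n M j d≡0 rewrite d≡0 = ℤP.*-zeroʳ (sign (toℕ j) * M fzero j)

-- After deleting the index punchIn c j, the index c sits at position swapPunch c j.
swapPunch : ∀ {n} → Fin (suc (suc n)) → Fin (suc n) → Fin (suc n)
swapPunch fzero    j        = fzero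
swapPunch (fsuc c) fzero    = c
swapPunch {suc n} (fsuc c) (fsuc j) = fsuc (swapPunch c j)

punchIn-swapPunch : ∀ {n} (c : Fin (suc (suc n))) j → punchIn (punchIn c j) (swapPunch c j) ≡ c
punchIn-swapPunch fzero    j        = refl
punchIn-swapPunch (fsuc c) fzero    = refl
punchIn-swapPunch {suc n} (fsuc c) (fsuc j) = cong fsuc (punchIn-swapPunch c j)

punchIn-punchIn-swapPunch : ∀ {n} (c : Fin (suc (suc n))) j b →
  punchIn (punchIn c j) (punchIn (swapPunch c j) b) ≡ punchIn c (punchIn j b)
punchIn-punchIn-swapPunch fzero    j        b        = refl
punchIn-punchIn-swapPunch (fsuc c) fzero    b        = refl
punchIn-punchIn-swapPunch {suc n} (fsuc c) (fsuc j) fzero    = refl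
punchIn-punchIn-swapPunch {suc n} (fsuc c) (fsuc j) (fsuc b) = cong fsuc (punchIn-punchIn-swapPunch c j b)

sign-swapPunch : ∀ {n} (c : Fin (suc (suc n))) j →
  sign (toℕ (punchIn c j) ℕ.+ toℕ (swapPunch c j)) ≡ - sign (toℕ j ℕ.+ toℕ c)
sign-swapPunch fzero j rewrite ℕP.+-identityʳ (toℕ j) = sign-suc (toℕ j)
sign-swapPunch (fsuc c) fzero rewrite sign-suc (toℕ c) = sym (ℤP.neg-involutive (sign (toℕ c)))
sign-swapPunch {suc n} (fsuc c) (fsuc j)
  rewrite ℕP.+-suc (toℕ (punchIn c j)) (toℕ (swapPunch c j)) | ℕP.+-suc (toℕ j) (toℕ c) =
    sign-swapPunch c j

det-zeroRow : ∀ n (M : Matrix n) i → (∀ k → M i k ≡ + 0) → det n M ≡ + 0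
det-zeroRow (suc n) M fzero Mᵢ≗0 =
  sumFin-zero (suc n) λ j → laplaceTerm-zero n M j (Mᵢ≗0 j)
det-zeroRow (suc (suc n)) M (fsuc i) Mᵢ≗0 = sumFin-zero (suc (suc n)) λ j →
  laplaceTerm-zeroMinor (suc n) M j (det-zeroRow (suc n) (minor fzero j M) i (Mᵢ≗0 ∘ punchIn j))

det-singleTerm : ∀ n (M : Matrix (suc n)) c → sumFin n (laplaceTerm n M ∘ punchIn c) ≡ + 0 →
                 det (suc n) M ≡ laplaceTerm n M c
det-singleTerm n M c others = begin
  det (suc n) M                                                ≡⟨ sumFin-punchIn n (laplaceTerm n M) c ⟩
  laplaceTerm n M c + sumFin n (laplaceTerm n M ∘ punchIn c)   ≡⟨ cong (λ y → laplaceTerm n M c + y) others ⟩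
  laplaceTerm n M c + + 0                                      ≡⟨ ℤP.+-identityʳ _ ⟩
  laplaceTerm n M c                                            ∎
  where open ≡-Reasoning

det-zeroCol : ∀ n (M : Matrix n) c → (∀ a → M a c ≡ + 0) → det n M ≡ + 0
laplaceTerms-zeroCol : ∀ n (M : Matrix (suc n)) c → (∀ a → M (fsuc a) c ≡ + 0) →
                       sumFin n (laplaceTerm n M ∘ punchIn c) ≡ + 0

det-zeroCol (suc n) M c Mᶜ≗0 =
  trans (det-singleTerm n M c (laplaceTerms-zeroCol n M c (Mᶜ≗0 ∘ fsuc)))
        (laplaceTerm-zero n M c (Mᶜ≗0 fzero))

laplaceTerms-zeroCol zero    M c Mᶜ≗0 = refl
laplaceTerms-zeroCol (suc n) M c Mᶜ≗0 = sumFin-zero (suc n) λ j →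
  laplaceTerm-zeroMinor (suc n) M (punchIn c j)
    (det-zeroCol (suc n) (minor fzero (punchIn c j) M) (swapPunch c j)
      (λ a → trans (cong (M (fsuc a)) (punchIn-swapPunch c j)) (Mᶜ≗0 a)))

sign-expansion : ∀ {n} (i : Fin (suc n)) (c : Fin (suc (suc n))) j →
  sign (toℕ (punchIn c j)) * sign (toℕ i ℕ.+ toℕ (swapPunch c j))
    ≡ sign (suc (toℕ i) ℕ.+ toℕ c) * sign (toℕ j)
sign-expansion i c j = begin
  sign p * sign (i′ ℕ.+ q)                     ≡⟨ cong (sign p *_) (sign-+ i′ q) ⟩
  sign p * (sign i′ * sign q)                  ≡⟨ exchange (sign p) (sign i′) (sign q) ⟩
  sign i′ * (sign p * sign q)                  ≡⟨ cong (sign i′ *_) (sym (sign-+ p q)) ⟩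
  sign i′ * sign (p ℕ.+ q)                     ≡⟨ cong (sign i′ *_) (sign-swapPunch c j) ⟩
  sign i′ * - sign (j′ ℕ.+ c′)                 ≡⟨ cong (λ s → sign i′ * - s) (sign-+ j′ c′) ⟩
  sign i′ * - (sign j′ * sign c′)              ≡⟨ pull (sign i′) (sign j′) (sign c′) ⟩
  - (sign i′ * sign c′) * sign j′              ≡⟨ cong (λ s → - s * sign j′) (sym (sign-+ i′ c′)) ⟩
  - sign (i′ ℕ.+ c′) * sign j′                 ≡⟨ cong (_* sign j′) (sym (sign-suc (i′ ℕ.+ c′))) ⟩
  sign (suc i′ ℕ.+ c′) * sign j′               ∎
  where
  open ≡-Reasoning
  p = toℕ (punchIn c j)
  q = toℕ (swapPunch c j)
  i′ = toℕ i
  j′ = toℕ j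
  c′ = toℕ c
  exchange : ∀ a b d → a * (b * d) ≡ b * (a * d)
  exchange = solve-∀
  pull : ∀ a b d → a * - (b * d) ≡ - (a * d) * b
  pull = solve-∀

sign-leaf : ∀ {n} (v : Fin (suc (suc n))) q →
  sign (toℕ v ℕ.+ toℕ (punchIn v q)) * sign (toℕ q ℕ.+ toℕ (swapPunch v q)) ≡ - (+ 1)
sign-leaf v q = begin
  sign (v′ ℕ.+ w′) * sign (q′ ℕ.+ p′)          ≡⟨ cong₂ _*_ (sign-+ v′ w′) (sign-+ q′ p′) ⟩
  (sign v′ * sign w′) * (sign q′ * sign p′)    ≡⟨ pair (sign v′) (sign w′) (sign q′) (sign p′) ⟩
  (sign w′ * sign p′) * (sign q′ * sign v′)    ≡⟨ cong₂ _*_ (sym (sign-+ w′ p′)) (sym (sign-+ q′ v′)) ⟩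
  sign (w′ ℕ.+ p′) * sign (q′ ℕ.+ v′)          ≡⟨ cong (_* sign (q′ ℕ.+ v′)) (sign-swapPunch v q) ⟩
  - sign (q′ ℕ.+ v′) * sign (q′ ℕ.+ v′)        ≡⟨ sym (ℤP.neg-distribˡ-* (sign (q′ ℕ.+ v′)) _) ⟩
  - (sign (q′ ℕ.+ v′) * sign (q′ ℕ.+ v′))      ≡⟨ cong -_ (sign-*-self (q′ ℕ.+ v′)) ⟩
  - (+ 1)                                      ∎
  where
  open ≡-Reasoning
  v′ = toℕ v
  w′ = toℕ (punchIn v q)
  q′ = toℕ q
  p′ = toℕ (swapPunch v q)
  pair : ∀ a b c d → (a * b) * (c * d) ≡ (b * d) * (c * a)
  pair = solve-∀

-- The inductive step shared by the single-entry expansions along a row or a column.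
expansion-step : ∀ n (M : Matrix (suc (suc n))) i c x →
  laplaceTerm (suc n) M c ≡ + 0 →
  (∀ j → det (suc n) (minor fzero (punchIn c j) M)
           ≡ sign (toℕ i ℕ.+ toℕ (swapPunch c j)) * x
             * det n (minor i (swapPunch c j) (minor fzero (punchIn c j) M))) →
  det (suc (suc n)) M ≡ sign (suc (toℕ i) ℕ.+ toℕ c) * x * det (suc n) (minor (fsuc i) c M)
expansion-step n M i c x termᶜ≡0 expand = begin
  det (suc (suc n)) M                                   ≡⟨ sumFin-punchIn (suc n) (laplaceTerm (suc n) M) c ⟩
  laplaceTerm (suc n) M c + sumFin (suc n) (laplaceTerm (suc n) M ∘ punchIn c)
                                                        ≡⟨ cong (_+ sumFin (suc n) (laplaceTerm (suc n) M ∘ punchIn c)) termᶜ≡0 ⟩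
  + 0 + sumFin (suc n) (laplaceTerm (suc n) M ∘ punchIn c)
                                                        ≡⟨ ℤP.+-identityˡ _ ⟩
  sumFin (suc n) (laplaceTerm (suc n) M ∘ punchIn c)    ≡⟨ sumFin-cong (suc n) term ⟩
  sumFin (suc n) (λ j → S * laplaceTerm n M′ j)         ≡⟨ sumFin-*ˡ (suc n) S (laplaceTerm n M′) ⟩
  S * det (suc n) M′                                    ∎
  where
  open ≡-Reasoning
  S = sign (suc (toℕ i) ℕ.+ toℕ c) * x
  M′ = minor (fsuc i) c M
  regroup : ∀ a b s t m d → a * b ≡ s * t → a * m * (b * x * d) ≡ s * x * (t * m * d)
  regroup a b s t m d ab≡st = begin
    a * m * (b * x * d)  ≡⟨ gather a b x m d ⟩
    a * b * (x * m * d)  ≡⟨ cong (_* (x * m * d)) ab≡st ⟩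
    s * t * (x * m * d)  ≡⟨ scatter s t x m d ⟩
    s * x * (t * m * d)  ∎
    where
    gather : ∀ a b x m d → a * m * (b * x * d) ≡ a * b * (x * m * d)
    gather = solve-∀
    scatter : ∀ s t x m d → s * t * (x * m * d) ≡ s * x * (t * m * d)
    scatter = solve-∀
  term : ∀ j → laplaceTerm (suc n) M (punchIn c j) ≡ S * laplaceTerm n M′ j
  term j = begin
    laplaceTerm (suc n) M (punchIn c j)   ≡⟨ cong (sign (toℕ (punchIn c j)) * M fzero (punchIn c j) *_) (expand j) ⟩
    sign (toℕ (punchIn c j)) * M fzero (punchIn c j)
      * (sign (toℕ i ℕ.+ toℕ (swapPunch c j)) * x * det n (minor i (swapPunch c j) (minor fzero (punchIn c j) M)))
        ≡⟨ cong (λ d → sign (toℕ (punchIn c j)) * M fzero (punchIn c j) * (sign (toℕ i ℕ.+ toℕ (swapPunch c j)) * x * d))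
                (det-cong n (λ a b → cong (M (fsuc (punchIn i a))) (punchIn-punchIn-swapPunch c j b))) ⟩
    sign (toℕ (punchIn c j)) * M fzero (punchIn c j)
      * (sign (toℕ i ℕ.+ toℕ (swapPunch c j)) * x * det n (minor fzero j M′))
        ≡⟨ regroup (sign (toℕ (punchIn c j))) (sign (toℕ i ℕ.+ toℕ (swapPunch c j)))
                   (sign (suc (toℕ i) ℕ.+ toℕ c)) (sign (toℕ j))
                   (M fzero (punchIn c j)) (det n (minor fzero j M′)) (sign-expansion i c j) ⟩
    S * laplaceTerm n M′ j ∎

det-rowSingle : ∀ n (M : Matrix (suc n)) i c x →
  (∀ k → k ≢ c → M i k ≡ + 0) → M i c ≡ x →
  det (suc n) M ≡ sign (toℕ i ℕ.+ toℕ c) * x * det n (minor i c M)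
det-rowSingle n M fzero c .(M fzero c) row refl = det-singleTerm n M c
  (sumFin-zero n λ j → laplaceTerm-zero n M (punchIn c j) (row _ (punchInᵢ≢i c j)))
det-rowSingle (suc n) M (fsuc i) c x row Mᵢᶜ≡x = expansion-step n M i c x
  (laplaceTerm-zeroMinor (suc n) M c
    (det-zeroRow (suc n) (minor fzero c M) i (λ k → row _ (punchInᵢ≢i c k))))
  (λ j → det-rowSingle n (minor fzero (punchIn c j) M) i (swapPunch c j) x
    (λ k k≢ → row _ (λ eq → k≢ (punchIn-injective (punchIn c j) k (swapPunch c j)
                                  (trans eq (sym (punchIn-swapPunch c j))))))
    (trans (cong (M (fsuc i)) (punchIn-swapPunch c j)) Mᵢᶜ≡x))

det-colSingle : ∀ n (M : Matrix (suc n)) i c x →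
  (∀ a → a ≢ i → M a c ≡ + 0) → M i c ≡ x →
  det (suc n) M ≡ sign (toℕ i ℕ.+ toℕ c) * x * det n (minor i c M)
det-colSingle n M fzero c .(M fzero c) col refl =
  det-singleTerm n M c (laplaceTerms-zeroCol n M c (λ a → col (fsuc a) λ ()))
det-colSingle (suc n) M (fsuc i) c x col Mᵢᶜ≡x = expansion-step n M i c x
  (laplaceTerm-zero (suc n) M c (col fzero λ ()))
  (λ j → det-colSingle n (minor fzero (punchIn c j) M) i (swapPunch c j) x
    (λ a a≢ → trans (cong (M (fsuc a)) (punchIn-swapPunch c j)) (col (fsuc a) (a≢ ∘ fsuc-injective)))
    (trans (cong (M (fsuc i)) (punchIn-swapPunch c j)) Mᵢᶜ≡x))

det-splitRow : ∀ n (M N O : Matrix (suc n)) i →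
  (∀ a k → a ≢ i → N a k ≡ M a k) → (∀ a k → a ≢ i → O a k ≡ M a k) →
  (∀ k → M i k ≡ N i k + O i k) → det (suc n) M ≡ det (suc n) N + det (suc n) O
det-splitRow n M N O fzero N≗M O≗M Mᵢ≗Nᵢ+Oᵢ =
  trans (sumFin-cong (suc n) term) (sumFin-distrib-+ (suc n) (laplaceTerm n N) (laplaceTerm n O))
  where
  distrib : ∀ s a b d → s * (a + b) * d ≡ s * a * d + s * b * d
  distrib = solve-∀
  term : ∀ j → laplaceTerm n M j ≡ laplaceTerm n N j + laplaceTerm n O j
  term j
    rewrite Mᵢ≗Nᵢ+Oᵢ j
          | det-cong n {minor fzero j N} {minor fzero j M} (λ a b → N≗M (fsuc a) (punchIn j b) λ ())
          | det-cong n {minor fzero j O} {minor fzero j M} (λ a b → O≗M (fsuc a) (punchIn j b) λ ()) =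
      distrib (sign (toℕ j)) (N fzero j) (O fzero j) (det n (minor fzero j M))
det-splitRow (suc n) M N O (fsuc i) N≗M O≗M Mᵢ≗Nᵢ+Oᵢ =
  trans (sumFin-cong (suc (suc n)) term) (sumFin-distrib-+ (suc (suc n)) (laplaceTerm (suc n) N) (laplaceTerm (suc n) O))
  where
  distrib : ∀ s a b d → s * a * (b + d) ≡ s * a * b + s * a * d
  distrib = solve-∀
  term : ∀ j → laplaceTerm (suc n) M j ≡ laplaceTerm (suc n) N j + laplaceTerm (suc n) O j
  term j
    rewrite det-splitRow n (minor fzero j M) (minor fzero j N) (minor fzero j O) i
              (λ a k a≢ → N≗M (fsuc a) (punchIn j k) (a≢ ∘ fsuc-injective))
              (λ a k a≢ → O≗M (fsuc a) (punchIn j k) (a≢ ∘ fsuc-injective))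
              (Mᵢ≗Nᵢ+Oᵢ ∘ punchIn j)
          | N≗M fzero j (λ ()) | O≗M fzero j (λ ()) =
      distrib (sign (toℕ j)) (M fzero j) (det (suc n) (minor fzero j N)) (det (suc n) (minor fzero j O))

replaceRow : ∀ {n} → Fin n → (Fin n → ℤ) → Matrix n → Matrix n
replaceRow i r M a k with a ≟ᶠ i
... | yes _ = r k
... | no  _ = M a k

replaceRow-≡ : ∀ {n} i r (M : Matrix n) k → replaceRow i r M i k ≡ r k
replaceRow-≡ i r M k with i ≟ᶠ i
... | yes _  = refl
... | no i≢i = ⊥-elim (i≢i refl)

replaceRow-≢ : ∀ {n} i r (M : Matrix n) a k → a ≢ i → replaceRow i r M a k ≡ M a k
replaceRow-≢ i r M a k a≢i with a ≟ᶠ i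
... | yes a≡i = ⊥-elim (a≢i a≡i)
... | no  _   = refl

unitRow : ∀ {n} → Fin n → ℤ → Fin n → ℤ
unitRow c x k with k ≟ᶠ c
... | yes _ = x
... | no  _ = + 0

unitRow-≡ : ∀ {n} (c : Fin n) x → unitRow c x c ≡ x
unitRow-≡ c x with c ≟ᶠ c
... | yes _  = refl
... | no c≢c = ⊥-elim (c≢c refl)

unitRow-≢ : ∀ {n} (c : Fin n) x k → k ≢ c → unitRow c x k ≡ + 0
unitRow-≢ c x k k≢c with k ≟ᶠ c
... | yes k≡c = ⊥-elim (k≢c k≡c)
... | no  _   = refl

-- For M = λI - A(G) and a leaf v with neighbour w = punchIn v q this is
-- φ(G) = λ φ(G - v) - φ(G - v - w).
det-leaf : ∀ n (M : Matrix (suc (suc n))) v q →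
  (∀ k → k ≢ v → k ≢ punchIn v q → M v k ≡ + 0) →
  (∀ a → a ≢ v → a ≢ punchIn v q → M a v ≡ + 0) →
  det (suc (suc n)) M ≡ M v v * det (suc n) (minor v v M)
                        - M v (punchIn v q) * M (punchIn v q) v * det n (minor q q (minor v v M))
det-leaf n M v q row col = begin
  det (suc (suc n)) M                           ≡⟨ det-splitRow (suc n) M N O v (replaceRow-≢ v rᴺ M) (replaceRow-≢ v rᴼ M) split ⟩
  det (suc (suc n)) N + det (suc (suc n)) O     ≡⟨ cong₂ _+_ detN detO ⟩
  M v v * D₁ + s₁ * M v w * (s₂ * M w v * D₂)   ≡⟨ regroup (M v v) D₁ s₁ s₂ (M v w) (M w v) D₂ (sign-leaf v q) ⟩
  M v v * D₁ - M v w * M w v * D₂               ∎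
  where
  open ≡-Reasoning
  w = punchIn v q
  p = swapPunch v q
  rᴺ = unitRow v (M v v)
  rᴼ = unitRow w (M v w)
  N = replaceRow v rᴺ M
  O = replaceRow v rᴼ M
  D₁ = det (suc n) (minor v v M)
  D₂ = det n (minor q q (minor v v M))
  s₁ = sign (toℕ v ℕ.+ toℕ w)
  s₂ = sign (toℕ q ℕ.+ toℕ p)
  w≢v : w ≢ v
  w≢v = punchInᵢ≢i v q
  split : ∀ k → M v k ≡ N v k + O v k
  split k rewrite replaceRow-≡ v rᴺ M k | replaceRow-≡ v rᴼ M k with k ≟ᶠ v
  ... | yes refl rewrite unitRow-≢ w (M k w) k (w≢v ∘ sym) = sym (ℤP.+-identityʳ _)
  ... | no k≢v with k ≟ᶠ w
  ...   | yes refl = sym (ℤP.+-identityˡ _)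
  ...   | no k≢w   = row k k≢v k≢w
  detN : det (suc (suc n)) N ≡ M v v * D₁
  detN = begin
    det (suc (suc n)) N
      ≡⟨ det-rowSingle (suc n) N v v (M v v)
           (λ k k≢v → trans (replaceRow-≡ v rᴺ M k) (unitRow-≢ v (M v v) k k≢v))
           (trans (replaceRow-≡ v rᴺ M v) (unitRow-≡ v (M v v))) ⟩
    sign (toℕ v ℕ.+ toℕ v) * M v v * det (suc n) (minor v v N)
      ≡⟨ cong₂ (λ s d → s * M v v * d)
           (trans (sign-+ (toℕ v) (toℕ v)) (sign-*-self (toℕ v)))
           (det-cong (suc n) (λ a b → replaceRow-≢ v rᴺ M (punchIn v a) (punchIn v b) (punchInᵢ≢i v a))) ⟩
    + 1 * M v v * D₁
      ≡⟨ cong (_* D₁) (ℤP.*-identityˡ (M v v)) ⟩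
    M v v * D₁ ∎
  detMinorVW : det (suc n) (minor v w M) ≡ s₂ * M w v * D₂
  detMinorVW = begin
    det (suc n) (minor v w M)
      ≡⟨ det-colSingle n (minor v w M) q p (M w v)
           (λ a a≢q → trans (cong (M (punchIn v a)) (punchIn-swapPunch v q))
                            (col (punchIn v a) (punchInᵢ≢i v a) (a≢q ∘ punchIn-injective v a q)))
           (cong (M w) (punchIn-swapPunch v q)) ⟩
    s₂ * M w v * det n (minor q p (minor v w M))
      ≡⟨ cong (s₂ * M w v *_) (det-cong n (λ a b → cong (M (punchIn v (punchIn q a))) (punchIn-punchIn-swapPunch v q b))) ⟩
    s₂ * M w v * D₂ ∎
  detO : det (suc (suc n)) O ≡ s₁ * M v w * (s₂ * M w v * D₂)
  detO = begin
    det (suc (suc n)) O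
      ≡⟨ det-rowSingle (suc n) O v w (M v w)
           (λ k k≢w → trans (replaceRow-≡ v rᴼ M k) (unitRow-≢ w (M v w) k k≢w))
           (trans (replaceRow-≡ v rᴼ M w) (unitRow-≡ w (M v w))) ⟩
    s₁ * M v w * det (suc n) (minor v w O)
      ≡⟨ cong (s₁ * M v w *_) (det-cong (suc n) (λ a b → replaceRow-≢ v rᴼ M (punchIn v a) (punchIn w b) (punchInᵢ≢i v a))) ⟩
    s₁ * M v w * det (suc n) (minor v w M)
      ≡⟨ cong (s₁ * M v w *_) detMinorVW ⟩
    s₁ * M v w * (s₂ * M w v * D₂) ∎
  regroup : ∀ a b s t x y d → s * t ≡ - (+ 1) → a * b + s * x * (t * y * d) ≡ a * b - x * y * d
  regroup a b s t x y d st≡-1 = begin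
    a * b + s * x * (t * y * d)   ≡⟨ cong (λ z → a * b + z) (gather s t x y d) ⟩
    a * b + s * t * (x * y * d)   ≡⟨ cong (λ z → a * b + z * (x * y * d)) st≡-1 ⟩
    a * b + - (+ 1) * (x * y * d) ≡⟨ cong (λ z → a * b + z) (ℤP.-1*i≡-i (x * y * d)) ⟩
    a * b - x * y * d             ∎
    where
    gather : ∀ s t x y d → s * x * (t * y * d) ≡ s * t * (x * y * d)
    gather = solve-∀

-- Graphs on ℕ

Adjacent : (ℕ → ℕ → ℤ) → ℕ → ℕ → Set
Adjacent G a b = G a b ≡ - (+ 1) × G b a ≡ - (+ 1)

Nonadjacent : (ℕ → ℕ → ℤ) → ℕ → ℕ → Set
Nonadjacent G a b = G a b ≡ + 0 × G b a ≡ + 0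

¬T⇒≡false : ∀ {x} → ¬ T x → x ≡ false
¬T⇒≡false {false} _  = refl
¬T⇒≡false {true}  ¬t = ⊥-elim (¬t _)

T⇔T⇒≡ : ∀ {x y} → T x ⇔ T y → x ≡ y
T⇔T⇒≡ {false} {false} _   = refl
T⇔T⇒≡ {false} {true}  x⇔y = ⊥-elim (Equivalence.from x⇔y _)
T⇔T⇒≡ {true}  {false} x⇔y = ⊥-elim (Equivalence.to x⇔y _)
T⇔T⇒≡ {true}  {true}  _   = refl

T⇒≡true : ∀ {x} → T x → x ≡ true
T⇒≡true {true} _ = refl

==⁻ : ∀ {a b} → T (a == b) → a ≡ b
==⁻ = toWitness

==⁺ : ∀ {a b} → a ≡ b → T (a == b)
==⁺ = fromWitness

<ᵇ⁻ : ∀ {a b} → T (a <ᵇ b) → a < b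
<ᵇ⁻ = toWitness

<ᵇ⁺ : ∀ {a b} → a < b → T (a <ᵇ b)
<ᵇ⁺ = fromWitness

==-refl : ∀ a → (a == a) ≡ true
==-refl a = T⇒≡true (==⁺ refl)

==-≢ : ∀ {a b} → a ≢ b → (a == b) ≡ false
==-≢ a≢b = ¬T⇒≡false (a≢b ∘ ==⁻)

charMatrix₂ : (ℕ → ℕ → Bool) → ℕ → ℕ → ℤ
charMatrix₂ E a b = + 2 * (if a == b then + 1 else + 0) - (if E a b ∨ E b a then + 1 else + 0)

charMatrix₂-diag : ∀ E a → ¬ T (E a a) → charMatrix₂ E a a ≡ + 2
charMatrix₂-diag E a ¬loop
  rewrite ==-refl a | ¬T⇒≡false {E a a ∨ E a a} (λ t → ¬loop (reduce (Equivalence.to T-∨ t))) = refl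

charMatrix₂-edge : ∀ E a b → a ≢ b → T (E a b) → Adjacent (charMatrix₂ E) a b
charMatrix₂-edge E a b a≢b e
  rewrite ==-≢ a≢b | ==-≢ (a≢b ∘ sym) | T⇒≡true e | ∨-zeroʳ (E b a) = refl , refl

charMatrix₂-nonedge : ∀ E a b → a ≢ b → ¬ T (E a b) → ¬ T (E b a) → Nonadjacent (charMatrix₂ E) a b
charMatrix₂-nonedge E a b a≢b ¬ab ¬ba
  rewrite ==-≢ a≢b | ==-≢ (a≢b ∘ sym) | ¬T⇒≡false ¬ab | ¬T⇒≡false ¬ba = refl , refl

charMatrix₂-cong : ∀ E E′ a b → (T (E a b) ⇔ T (E′ a b)) → (T (E b a) ⇔ T (E′ b a)) →
                   charMatrix₂ E a b ≡ charMatrix₂ E′ a b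
charMatrix₂-cong E E′ a b ab ba rewrite T⇔T⇒≡ ab | T⇔T⇒≡ ba = refl

punchInℕ : ℕ → ℕ → ℕ
punchInℕ zero    x       = suc x
punchInℕ (suc p) zero    = zero
punchInℕ (suc p) (suc x) = suc (punchInℕ p x)

toℕ-punchIn : ∀ {n} (u : Fin (suc n)) i → toℕ (punchIn u i) ≡ punchInℕ (toℕ u) (toℕ i)
toℕ-punchIn fzero    i        = refl
toℕ-punchIn (fsuc u) fzero    = refl
toℕ-punchIn (fsuc u) (fsuc i) = cong suc (toℕ-punchIn u i)

punchInℕ-< : ∀ {p x} → x < p → punchInℕ p x ≡ x
punchInℕ-< {suc p} {zero}  _         = refl
punchInℕ-< {suc p} {suc x} (s≤s x<p) = cong suc (punchInℕ-< x<p)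

punchInℕ-≥ : ∀ {p x} → p ≤ x → punchInℕ p x ≡ suc x
punchInℕ-≥ {zero}  _         = refl
punchInℕ-≥ {suc p} (s≤s p≤x) = cong suc (punchInℕ-≥ p≤x)

punchInℕ-injective : ∀ p {x y} → punchInℕ p x ≡ punchInℕ p y → x ≡ y
punchInℕ-injective zero    refl = refl
punchInℕ-injective (suc p) {zero}  {zero}  _  = refl
punchInℕ-injective (suc p) {suc x} {suc y} eq = cong suc (punchInℕ-injective p (ℕP.suc-injective eq))

punchInℕ-≤ : ∀ p x → punchInℕ p x ≤ suc x
punchInℕ-≤ zero    x       = ℕP.≤-refl
punchInℕ-≤ (suc p) zero    = z≤n
punchInℕ-≤ (suc p) (suc x) = s≤s (punchInℕ-≤ p x)

removeVertex : ℕ → (ℕ → ℕ → ℤ) → ℕ → ℕ → ℤ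
removeVertex u G a b = G (punchInℕ u a) (punchInℕ u b)

-- Opaque because conversion checking would otherwise evaluate det at numeral sizes,
-- which takes exponential time.
opaque
  detOn : ℕ → (ℕ → ℕ → ℤ) → ℤ
  detOn k G = det k (λ i j → G (toℕ i) (toℕ j))

opaque
  unfolding detOn

  detOn-cong : ∀ k {G H : ℕ → ℕ → ℤ} → (∀ a b → a < k → b < k → G a b ≡ H a b) → detOn k G ≡ detOn k H
  detOn-cong k G≗H = det-cong k (λ i j → G≗H (toℕ i) (toℕ j) (toℕ<n i) (toℕ<n j))

  detOn-zero : ∀ G → detOn 0 G ≡ + 1
  detOn-zero G = refl

  detOn-one : ∀ G → detOn 1 G ≡ G 0 0
  detOn-one G = unit (G 0 0)
    where
    unit : ∀ x → + 1 * x * + 1 + + 0 ≡ x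
    unit = solve-∀

  charPolyAt-P : ∀ n1 n2 r m1 m2 →
    charPolyAt (P n1 n2 r m1 m2) (+ 2) ≡ detOn (r ℕ.+ n1 ℕ.+ n2) (charMatrix₂ (edgeP n1 n2 r m1 m2))
  charPolyAt-P n1 n2 r m1 m2 = refl

  detOn-leafFirst : ∀ k G → (∀ a → 1 < a → a < 2 ℕ.+ k → Nonadjacent G 0 a) →
    detOn (2 ℕ.+ k) G ≡ G 0 0 * detOn (suc k) (λ a b → G (suc a) (suc b))
                        - G 0 1 * G 1 0 * detOn k (λ a b → G (2 ℕ.+ a) (2 ℕ.+ b))
  detOn-leafFirst k G others = det-leaf k (λ i j → G (toℕ i) (toℕ j)) fzero fzero row col
    where
    row : ∀ (j : Fin (2 ℕ.+ k)) → j ≢ fzero → j ≢ fsuc fzero → G 0 (toℕ j) ≡ + 0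
    row fzero           j≢0 _   = ⊥-elim (j≢0 refl)
    row (fsuc fzero)    _   j≢1 = ⊥-elim (j≢1 refl)
    row (fsuc (fsuc j)) _   _   = proj₁ (others (2 ℕ.+ toℕ j) (s≤s (s≤s z≤n)) (toℕ<n (fsuc (fsuc j))))
    col : ∀ (j : Fin (2 ℕ.+ k)) → j ≢ fzero → j ≢ fsuc fzero → G (toℕ j) 0 ≡ + 0
    col fzero           j≢0 _   = ⊥-elim (j≢0 refl)
    col (fsuc fzero)    _   j≢1 = ⊥-elim (j≢1 refl)
    col (fsuc (fsuc j)) _   _   = proj₂ (others (2 ℕ.+ toℕ j) (s≤s (s≤s z≤n)) (toℕ<n (fsuc (fsuc j))))

  detOn-leaf : ∀ m G w → w < suc m →
    (∀ a → a < suc m → a ≢ w → Nonadjacent G (suc m) a) →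
    detOn (suc (suc m)) G ≡ G (suc m) (suc m) * detOn (suc m) G
                            - G (suc m) w * G w (suc m) * detOn m (removeVertex w G)
  detOn-leaf m G w w<sm others = begin
    det (suc (suc m)) M
      ≡⟨ det-leaf m M v q row col ⟩
    M v v * det (suc m) (minor v v M) - M v (punchIn v q) * M (punchIn v q) v * det m (minor q q (minor v v M))
      ≡⟨ cong₂ (λ a b → G a a * det (suc m) (minor v v M) - G a b * G b a * det m (minor q q (minor v v M)))
               toℕ-v toℕ-w′ ⟩
    G (suc m) (suc m) * det (suc m) (minor v v M) - G (suc m) w * G w (suc m) * det m (minor q q (minor v v M))
      ≡⟨ cong₂ (λ d e → G (suc m) (suc m) * d - G (suc m) w * G w (suc m) * e)
               (det-cong (suc m) (λ a b → cong₂ G (toℕ-below a) (toℕ-below b)))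
               (det-cong m (λ a b → cong₂ G (toℕ-removed a) (toℕ-removed b))) ⟩
    G (suc m) (suc m) * detOn (suc m) G - G (suc m) w * G w (suc m) * detOn m (removeVertex w G)
      ∎
    where
    open ≡-Reasoning
    M : Matrix (suc (suc m))
    M i j = G (toℕ i) (toℕ j)
    v : Fin (suc (suc m))
    v = fromℕ< (ℕP.n<1+n (suc m))
    q : Fin (suc m)
    q = fromℕ< w<sm
    toℕ-v : toℕ v ≡ suc m
    toℕ-v = toℕ-fromℕ< (ℕP.n<1+n (suc m))
    toℕ-below : (a : Fin (suc m)) → toℕ (punchIn v a) ≡ toℕ a
    toℕ-below a = trans (toℕ-punchIn v a) (trans (cong (λ p → punchInℕ p (toℕ a)) toℕ-v) (punchInℕ-< (toℕ<n a)))
    toℕ-w′ : toℕ (punchIn v q) ≡ w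
    toℕ-w′ = trans (toℕ-below q) (toℕ-fromℕ< w<sm)
    toℕ-removed : (a : Fin m) → toℕ (punchIn v (punchIn q a)) ≡ punchInℕ w (toℕ a)
    toℕ-removed a = trans (toℕ-below (punchIn q a))
                     (trans (toℕ-punchIn q a) (cong (λ p → punchInℕ p (toℕ a)) (toℕ-fromℕ< w<sm)))
    other : ∀ k → k ≢ v → k ≢ punchIn v q → Nonadjacent G (suc m) (toℕ k)
    other k k≢v k≢w′ = others (toℕ k)
      (ℕP.≤∧≢⇒< (ℕ.s≤s⁻¹ (toℕ<n k)) (λ eq → k≢v (toℕ-injective (trans eq (sym toℕ-v)))))
      (λ eq → k≢w′ (toℕ-injective (trans eq (sym toℕ-w′))))
    row : ∀ k → k ≢ v → k ≢ punchIn v q → M v k ≡ + 0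
    row k k≢v k≢w′ = trans (cong (λ a → G a (toℕ k)) toℕ-v) (proj₁ (other k k≢v k≢w′))
    col : ∀ k → k ≢ v → k ≢ punchIn v q → M k v ≡ + 0
    col k k≢v k≢w′ = trans (cong (G (toℕ k)) toℕ-v) (proj₂ (other k k≢v k≢w′))

-- For the pendant path X = 2 + m, Y = 1 + m attached at u:
-- φ(G, x) = (x² - 1) φ(G - X - Y, x) - x φ(G - X - Y - u, x).
detOn-pendantPath : ∀ m G u x → u < suc m →
  G (2 ℕ.+ m) (2 ℕ.+ m) ≡ x → G (suc m) (suc m) ≡ x →
  Adjacent G (suc m) (2 ℕ.+ m) → Adjacent G u (suc m) →
  (∀ a → a < suc m → Nonadjacent G (2 ℕ.+ m) a) →
  (∀ a → a < suc m → a ≢ u → Nonadjacent G (suc m) a) →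
  detOn (3 ℕ.+ m) G ≡ (x * x - + 1) * detOn (suc m) G - x * detOn m (removeVertex u G)
detOn-pendantPath m G u x u<sm Gˣˣ≡x Gʸʸ≡x Y~X u~Y X-others Y-others = begin
  detOn (3 ℕ.+ m) G
    ≡⟨ detOn-leaf (suc m) G (suc m) ℕP.≤-refl
         (λ a a<2+m a≢Y → X-others a (ℕP.≤∧≢⇒< (ℕ.s≤s⁻¹ a<2+m) a≢Y)) ⟩
  G (2 ℕ.+ m) (2 ℕ.+ m) * detOn (2 ℕ.+ m) G - G (2 ℕ.+ m) (suc m) * G (suc m) (2 ℕ.+ m) * detOn (suc m) (removeVertex (suc m) G)
    ≡⟨ cong₂ (λ d e → d * detOn (2 ℕ.+ m) G - e * detOn (suc m) (removeVertex (suc m) G))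
             Gˣˣ≡x (cong₂ _*_ (proj₂ Y~X) (proj₁ Y~X)) ⟩
  x * detOn (2 ℕ.+ m) G - - (+ 1) * - (+ 1) * detOn (suc m) (removeVertex (suc m) G)
    ≡⟨ cong₂ (λ d e → x * d - - (+ 1) * - (+ 1) * e) removeY
             (detOn-cong (suc m) (λ a b a<sm b<sm → cong₂ G (punchInℕ-< a<sm) (punchInℕ-< b<sm))) ⟩
  x * (x * A - - (+ 1) * - (+ 1) * B) - - (+ 1) * - (+ 1) * A
    ≡⟨ collect x A B ⟩
  (x * x - + 1) * A - x * B
    ∎
  where
  open ≡-Reasoning
  A = detOn (suc m) G
  B = detOn m (removeVertex u G)
  removeY : detOn (2 ℕ.+ m) G ≡ x * A - - (+ 1) * - (+ 1) * B
  removeY = begin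
    detOn (2 ℕ.+ m) G
      ≡⟨ detOn-leaf m G u u<sm Y-others ⟩
    G (suc m) (suc m) * A - G (suc m) u * G u (suc m) * B
      ≡⟨ cong₂ (λ d e → d * A - e * B) Gʸʸ≡x (cong₂ _*_ (proj₂ u~Y) (proj₁ u~Y)) ⟩
    x * A - - (+ 1) * - (+ 1) * B
      ∎
  collect : ∀ x A B → x * (x * A - - (+ 1) * - (+ 1) * B) - - (+ 1) * - (+ 1) * A ≡ (x * x - + 1) * A - x * B
  collect = solve-∀

-- Induced subgraphs of a path

pathEdge : ℕ → ℕ → Bool
pathEdge a b = suc a == b

pathMatrix : ℕ → ℕ → ℤ
pathMatrix = charMatrix₂ pathEdge

pathMatrix-diag : ∀ a → pathMatrix a a ≡ + 2
pathMatrix-diag a = charMatrix₂-diag pathEdge a (ℕP.1+n≢n ∘ ==⁻)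

pathMatrix-adjacent : ∀ a → Adjacent pathMatrix a (suc a)
pathMatrix-adjacent a = charMatrix₂-edge pathEdge a (suc a) (ℕP.1+n≢n ∘ sym) (==⁺ refl)

pathMatrix-far : ∀ {a b} → suc a < b → Nonadjacent pathMatrix a b
pathMatrix-far {a} {b} 1+a<b = charMatrix₂-nonedge pathEdge a b
  (ℕP.<⇒≢ (ℕP.<-trans (ℕP.n<1+n a) 1+a<b))
  (ℕP.<⇒≢ 1+a<b ∘ ==⁻)
  (λ t → ℕP.<-asym (ℕP.<-trans (ℕP.n<1+n a) 1+a<b) (ℕP.≤-reflexive (==⁻ t)))

-- φ(P, 2) for the subgraph P of the path 0 - 1 - 2 - ⋯ induced by φ 0, …, φ (k - 1).
detPath : ℕ → (ℕ → ℕ) → ℤ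
detPath k φ = detOn k (λ a b → pathMatrix (φ a) (φ b))

Increasing : (ℕ → ℕ) → Set
Increasing φ = ∀ x → φ x < φ (suc x)

Increasing-mono : ∀ {φ} → Increasing φ → ∀ {x y} → x < y → φ x < φ y
Increasing-mono {φ} inc {x} {suc y} (s≤s x≤y) with ℕP.m≤n⇒m<n∨m≡n x≤y
... | inj₁ x<y  = ℕP.<-trans (Increasing-mono inc x<y) (inc y)
... | inj₂ refl = inc x

Consecutive : (ℕ → ℕ) → ℕ → Set
Consecutive φ b = ∀ i → i < b → φ (suc i) ≡ suc (φ i)

detPath-leaf : ∀ k φ → Increasing φ →
  detPath (2 ℕ.+ k) φ ≡ + 2 * detPath (suc k) (φ ∘ suc)
                         - pathMatrix (φ 0) (φ 1) * pathMatrix (φ 1) (φ 0) * detPath k (φ ∘ suc ∘ suc)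
detPath-leaf k φ inc =
  trans (detOn-leafFirst k (λ a b → pathMatrix (φ a) (φ b))
           (λ a 1<a _ → pathMatrix-far (ℕP.≤-<-trans (inc 0) (Increasing-mono inc 1<a))))
        (cong (λ d → d * detPath (suc k) (φ ∘ suc) - pathMatrix (φ 0) (φ 1) * pathMatrix (φ 1) (φ 0) * detPath k (φ ∘ suc ∘ suc))
              (pathMatrix-diag (φ 0)))

-- A maximal run φ 0, …, φ b of consecutive vertices splits off the component P_(b+1),
-- and φ(P_(b+1), 2) = b + 2.
detPath-block : ∀ b k φ → Increasing φ → Consecutive φ b → (k ≡ 0 ⊎ φ (suc b) ≢ suc (φ b)) →
  detPath (suc b ℕ.+ k) φ ≡ + (2 ℕ.+ b) * detPath k (λ x → φ (suc b ℕ.+ x))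
detPath-block zero zero    φ inc cons _ =
  trans (detOn-one (λ a b → pathMatrix (φ a) (φ b)))
        (trans (pathMatrix-diag (φ 0)) (cong (+ 2 *_) (sym (detOn-zero (λ a b → pathMatrix (φ (suc a)) (φ (suc b)))))))
detPath-block zero (suc k) φ inc cons (inj₁ ())
detPath-block zero (suc k) φ inc cons (inj₂ gap) = begin
  detPath (2 ℕ.+ k) φ
    ≡⟨ detPath-leaf k φ inc ⟩
  + 2 * detPath (suc k) (φ ∘ suc) - pathMatrix (φ 0) (φ 1) * pathMatrix (φ 1) (φ 0) * detPath k (φ ∘ suc ∘ suc)
    ≡⟨ cong (λ e → + 2 * detPath (suc k) (φ ∘ suc) - e * pathMatrix (φ 1) (φ 0) * detPath k (φ ∘ suc ∘ suc))
            (proj₁ (pathMatrix-far (ℕP.≤∧≢⇒< (inc 0) (gap ∘ sym)))) ⟩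
  + 2 * detPath (suc k) (φ ∘ suc) - + 0
    ≡⟨ ℤP.+-identityʳ _ ⟩
  + 2 * detPath (suc k) (φ ∘ suc)
    ∎
  where open ≡-Reasoning
detPath-block (suc b) k φ inc cons gap = begin
  detPath (2 ℕ.+ (b ℕ.+ k)) φ
    ≡⟨ detPath-leaf (b ℕ.+ k) φ inc ⟩
  + 2 * detPath (suc b ℕ.+ k) (φ ∘ suc) - pathMatrix (φ 0) (φ 1) * pathMatrix (φ 1) (φ 0) * detPath (b ℕ.+ k) (φ ∘ suc ∘ suc)
    ≡⟨ cong₂ (λ d e → + 2 * detPath (suc b ℕ.+ k) (φ ∘ suc) - d * e * detPath (b ℕ.+ k) (φ ∘ suc ∘ suc))
             (proj₁ φ₀~φ₁) (proj₂ φ₀~φ₁) ⟩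
  + 2 * detPath (suc b ℕ.+ k) (φ ∘ suc) - - (+ 1) * - (+ 1) * detPath (b ℕ.+ k) (φ ∘ suc ∘ suc)
    ≡⟨ cong₂ (λ d e → + 2 * d - - (+ 1) * - (+ 1) * e)
             (detPath-block b k (φ ∘ suc) (inc ∘ suc) (λ i i<b → cons (suc i) (s≤s i<b)) gap)
             (twoAhead b cons gap) ⟩
  + 2 * (+ (2 ℕ.+ b) * X) - - (+ 1) * - (+ 1) * (+ (suc b) * X)
    ≡⟨ collect (+ b) X ⟩
  + (3 ℕ.+ b) * X
    ∎
  where
  open ≡-Reasoning
  X = detPath k (λ x → φ (2 ℕ.+ b ℕ.+ x))
  φ₀~φ₁ : Adjacent pathMatrix (φ 0) (φ 1)
  φ₀~φ₁ = subst (Adjacent pathMatrix (φ 0)) (sym (cons 0 (s≤s z≤n))) (pathMatrix-adjacent (φ 0))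
  twoAhead : ∀ b → Consecutive φ (suc b) → (k ≡ 0 ⊎ φ (2 ℕ.+ b) ≢ suc (φ (suc b))) →
             detPath (b ℕ.+ k) (φ ∘ suc ∘ suc) ≡ + (suc b) * detPath k (λ x → φ (2 ℕ.+ b ℕ.+ x))
  twoAhead zero    _    _   = sym (ℤP.*-identityˡ _)
  twoAhead (suc b) cons gap =
    detPath-block b k (φ ∘ suc ∘ suc) (inc ∘ suc ∘ suc) (λ i i<b → cons (2 ℕ.+ i) (s≤s (s≤s i<b))) gap
  collect : ∀ B X → + 2 * ((+ 2 + B) * X) - - (+ 1) * - (+ 1) * ((+ 1 + B) * X) ≡ (+ 3 + B) * X
  collect = solve-∀

detPath-interval : ∀ k φ → Increasing φ → Consecutive φ k → detPath (suc k) φ ≡ + (2 ℕ.+ k)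
detPath-interval k φ inc cons = begin
  detPath (suc k) φ            ≡⟨ cong (λ n → detPath n φ) (sym (ℕP.+-identityʳ (suc k))) ⟩
  detPath (suc k ℕ.+ 0) φ      ≡⟨ detPath-block k 0 φ inc cons (inj₁ refl) ⟩
  + (2 ℕ.+ k) * detPath 0 (λ x → φ (suc k ℕ.+ x))
                               ≡⟨ cong (+ (2 ℕ.+ k) *_) (detOn-zero _) ⟩
  + (2 ℕ.+ k) * + 1            ≡⟨ ℤP.*-identityʳ _ ⟩
  + (2 ℕ.+ k)                  ∎
  where open ≡-Reasoning

punchInℕ-increasing : ∀ p → Increasing (punchInℕ p)
punchInℕ-increasing zero    x       = ℕP.n<1+n (suc x)
punchInℕ-increasing (suc p) zero    = s≤s z≤n
punchInℕ-increasing (suc p) (suc x) = s≤s (punchInℕ-increasing p x)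

Increasing-∘ : ∀ {φ ψ} → Increasing φ → Increasing ψ → Increasing (φ ∘ ψ)
Increasing-∘ incφ incψ x = Increasing-mono incφ (incψ x)

shifted-punchInℕ-suc : ∀ c a i → c ℕ.+ punchInℕ a (a ℕ.+ suc i) ≡ suc (c ℕ.+ punchInℕ a (a ℕ.+ i))
shifted-punchInℕ-suc c a i
  rewrite punchInℕ-≥ (ℕP.m≤m+n a (suc i)) | punchInℕ-≥ (ℕP.m≤m+n a i) | ℕP.+-suc a i =
    ℕP.+-suc c (suc (a ℕ.+ i))

-- The path c, c + 1, …, c + a + b + 1 with the vertex c + a removed is P_a ∪ P_(b+1).
detPath-punchIn : ∀ c a b → detPath (a ℕ.+ suc b) (λ x → c ℕ.+ punchInℕ a x) ≡ + (suc a) * + (2 ℕ.+ b)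
detPath-punchIn c zero b =
  trans (detPath-interval b (λ x → c ℕ.+ suc x) inc (λ i _ → shifted-punchInℕ-suc c 0 i))
        (sym (ℤP.*-identityˡ _))
  where
  inc : Increasing (λ x → c ℕ.+ suc x)
  inc x = ℕP.+-monoʳ-< c (ℕP.n<1+n (suc x))
detPath-punchIn c (suc a) b = begin
  detPath (suc a ℕ.+ suc b) φ
    ≡⟨ detPath-block a (suc b) φ inc below (inj₂ gap) ⟩
  + (2 ℕ.+ a) * detPath (suc b) (λ x → φ (suc a ℕ.+ x))
    ≡⟨ cong (+ (2 ℕ.+ a) *_)
            (detPath-interval b (λ x → φ (suc a ℕ.+ x)) (ℕP.≤-reflexive ∘ sym ∘ above) (λ i _ → above i)) ⟩
  + (2 ℕ.+ a) * + (2 ℕ.+ b)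
    ∎
  where
  open ≡-Reasoning
  φ = λ x → c ℕ.+ punchInℕ (suc a) x
  inc : Increasing φ
  inc x = ℕP.+-monoʳ-< c (punchInℕ-increasing (suc a) x)
  below : Consecutive φ a
  below i i<a rewrite punchInℕ-< {suc a} (s≤s i<a) | punchInℕ-< {suc a} (ℕP.<-trans i<a (ℕP.n<1+n a)) =
    ℕP.+-suc c i
  gap : φ (suc a) ≢ suc (φ a)
  gap rewrite punchInℕ-≥ {suc a} (ℕP.≤-refl {suc a}) | punchInℕ-< {suc a} (ℕP.n<1+n a) | ℕP.+-suc c (suc a) =
    ℕP.1+n≢n ∘ ℕP.+-cancelˡ-≡ c _ _ ∘ ℕP.suc-injective
  above : ∀ i → φ (suc a ℕ.+ suc i) ≡ suc (φ (suc a ℕ.+ i))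
  above = shifted-punchInℕ-suc c (suc a)

-- The graphs P_{n1,n2;r}^{m1,m2} and H_n

T-∨⁺ˡ : ∀ {x y} → T x → T (x ∨ y)
T-∨⁺ˡ = Equivalence.from T-∨ ∘ inj₁

T-∨⁺ʳ : ∀ x {y} → T y → T (x ∨ y)
T-∨⁺ʳ x = Equivalence.from T-∨ ∘ inj₂

T-∧⁺ : ∀ {x y} → T x → T y → T (x ∧ y)
T-∧⁺ tx ty = Equivalence.from T-∧ (tx , ty)

EdgeP : (n1 n2 r m1 m2 u v : ℕ) → Set
EdgeP n1 n2 r m1 m2 u v =
    (suc u ≡ v × v < r)
  ⊎ (u ≡ m1 × v ≡ r)
  ⊎ (r ∸ 1 < u × suc u ≡ v × v < r ℕ.+ n1)
  ⊎ (u ≡ m2 × v ≡ r ℕ.+ n1)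
  ⊎ (r ℕ.+ n1 ∸ 1 < u × suc u ≡ v × v < r ℕ.+ n1 ℕ.+ n2)

edgeP-sound : ∀ {n1 n2 r m1 m2 u v} → T (edgeP n1 n2 r m1 m2 u v) → EdgeP n1 n2 r m1 m2 u v
edgeP-sound = Sum.map (eq×lt ∘ ∧⁻) (Sum.map (eq×eq ∘ ∧⁻)
  (Sum.map (lt×eq×lt ∘ ∧⁻) (Sum.map (eq×eq ∘ ∧⁻) (lt×eq×lt ∘ ∧⁻) ∘ ∨⁻) ∘ ∨⁻) ∘ ∨⁻) ∘ ∨⁻
  where
  ∨⁻ : ∀ {x y} → T (x ∨ y) → T x ⊎ T y
  ∨⁻ = Equivalence.to T-∨
  ∧⁻ : ∀ {x y} → T (x ∧ y) → T x × T y
  ∧⁻ = Equivalence.to T-∧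
  eq×lt : ∀ {a b c d} → T (a == b) × T (c <ᵇ d) → a ≡ b × c < d
  eq×lt = Product.map ==⁻ <ᵇ⁻
  eq×eq : ∀ {a b c d} → T (a == b) × T (c == d) → a ≡ b × c ≡ d
  eq×eq = Product.map ==⁻ ==⁻
  lt×eq×lt : ∀ {a b c d e f} → T (a <ᵇ b) × T ((c == d) ∧ (e <ᵇ f)) → a < b × c ≡ d × e < f
  lt×eq×lt = Product.map <ᵇ⁻ (eq×lt ∘ ∧⁻)

module _ {n1 n2 r m1 m2 u v : ℕ} where

  -- The left disjuncts of edgeP, which unification cannot infer from the goal.
  private
    clause₁ clause₂ clause₃ clause₄ : Bool
    clause₁ = (suc u == v) ∧ (v <ᵇ r)
    clause₂ = (u == m1) ∧ (v == r)
    clause₃ = ((r ∸ 1) <ᵇ u) ∧ (suc u == v) ∧ (v <ᵇ (r ℕ.+ n1))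
    clause₄ = (u == m2) ∧ (v == (r ℕ.+ n1))

  edgeP-complete : EdgeP n1 n2 r m1 m2 u v → T (edgeP n1 n2 r m1 m2 u v)
  edgeP-complete (inj₁ (p , q)) = T-∨⁺ˡ (T-∧⁺ (==⁺ p) (<ᵇ⁺ q))
  edgeP-complete (inj₂ (inj₁ (p , q))) = T-∨⁺ʳ clause₁ (T-∨⁺ˡ (T-∧⁺ (==⁺ p) (==⁺ q)))
  edgeP-complete (inj₂ (inj₂ (inj₁ (p , q , s)))) =
    T-∨⁺ʳ clause₁ (T-∨⁺ʳ clause₂ (T-∨⁺ˡ (T-∧⁺ (<ᵇ⁺ p) (T-∧⁺ (==⁺ q) (<ᵇ⁺ s)))))
  edgeP-complete (inj₂ (inj₂ (inj₂ (inj₁ (p , q))))) =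
    T-∨⁺ʳ clause₁ (T-∨⁺ʳ clause₂ (T-∨⁺ʳ clause₃ (T-∨⁺ˡ (T-∧⁺ (==⁺ p) (==⁺ q)))))
  edgeP-complete (inj₂ (inj₂ (inj₂ (inj₂ (p , q , s))))) =
    T-∨⁺ʳ clause₁ (T-∨⁺ʳ clause₂ (T-∨⁺ʳ clause₃ (T-∨⁺ʳ clause₄ (T-∧⁺ (<ᵇ⁺ p) (T-∧⁺ (==⁺ q) (<ᵇ⁺ s))))))

-- For numerals a and b both sides compute, so this proves a + t < b + t from a < b by evaluation,
-- and refutes a + t < b + t when T (a <ᵇ b) evaluates to ⊥.
offset-< : ∀ {a b} t → T (a ℕ.<ᵇ b) → a ℕ.+ t < b ℕ.+ t
offset-< {a} {b} t a<b = ℕP.+-monoˡ-< t (ℕP.<ᵇ⇒< a b a<b)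

offset-<⁻ : ∀ a b t → a ℕ.+ t < b ℕ.+ t → T (a ℕ.<ᵇ b)
offset-<⁻ a b t = ℕP.<⇒<ᵇ ∘ ℕP.+-cancelʳ-< t a b

6+t+2≡8+t : ∀ t → 6 ℕ.+ t ℕ.+ 2 ≡ 8 ℕ.+ t
6+t+2≡8+t t = cong (6 ℕ.+_) (ℕP.+-comm t 2)

6+t+2+2≡10+t : ∀ t → 6 ℕ.+ t ℕ.+ 2 ℕ.+ 2 ≡ 10 ℕ.+ t
6+t+2+2≡10+t t = trans (cong (ℕ._+ 2) (6+t+2≡8+t t)) (cong (8 ℕ.+_) (ℕP.+-comm t 2))

data HEdge (t : ℕ) : ℕ → ℕ → Set where
  spine : ∀ {u} → suc u < 6 ℕ.+ t → HEdge t u (suc u)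
  leg₁  : HEdge t 2 (6 ℕ.+ t)
  foot₁ : HEdge t (6 ℕ.+ t) (7 ℕ.+ t)
  leg₂  : HEdge t (3 ℕ.+ t) (8 ℕ.+ t)
  foot₂ : HEdge t (8 ℕ.+ t) (9 ℕ.+ t)

hEdge : ℕ → ℕ → ℕ → Bool
hEdge t = edgeP 2 2 (6 ℕ.+ t) 2 (3 ℕ.+ t)

hEdge-sound : ∀ {t u v} → T (hEdge t u v) → HEdge t u v
hEdge-sound {t} {u} {v} e with edgeP-sound {2} {2} {6 ℕ.+ t} {2} {3 ℕ.+ t} {u} {v} e
... | inj₁ (refl , v<r) = spine v<r
... | inj₂ (inj₁ (refl , refl)) = leg₁
... | inj₂ (inj₂ (inj₁ (r≤u , refl , v<r+2))) = subst (λ u → HEdge t u (suc u)) (sym u≡6+t) foot₁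
  where
  u≡6+t : u ≡ 6 ℕ.+ t
  u≡6+t = ℕP.≤-antisym (ℕ.s≤s⁻¹ (ℕ.s≤s⁻¹ (subst (suc u <_) (6+t+2≡8+t t) v<r+2))) r≤u
... | inj₂ (inj₂ (inj₂ (inj₁ (refl , refl)))) = subst (HEdge t (3 ℕ.+ t)) (sym (6+t+2≡8+t t)) leg₂
... | inj₂ (inj₂ (inj₂ (inj₂ (r+1≤u , refl , v<r+4)))) = subst (λ u → HEdge t u (suc u)) (sym u≡8+t) foot₂
  where
  u≡8+t : u ≡ 8 ℕ.+ t
  u≡8+t = ℕP.≤-antisym (ℕ.s≤s⁻¹ (ℕ.s≤s⁻¹ (subst (suc u <_) (6+t+2+2≡10+t t) v<r+4)))
                       (subst (_< u) (cong (_∸ 1) (6+t+2≡8+t t)) r+1≤u)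

hEdge-complete : ∀ {t u v} → HEdge t u v → T (hEdge t u v)
hEdge-complete {t} e = edgeP-complete (clause e)
  where
  clause : ∀ {u v} → HEdge t u v → EdgeP 2 2 (6 ℕ.+ t) 2 (3 ℕ.+ t) u v
  clause (spine u<r) = inj₁ (refl , u<r)
  clause leg₁ = inj₂ (inj₁ (refl , refl))
  clause foot₁ = inj₂ (inj₂ (inj₁ (ℕP.n<1+n _ , refl , subst (λ a → 7 ℕ.+ t < a) (sym (6+t+2≡8+t t)) (ℕP.n<1+n _))))
  clause leg₂ = inj₂ (inj₂ (inj₂ (inj₁ (refl , sym (6+t+2≡8+t t)))))
  clause foot₂ = inj₂ (inj₂ (inj₂ (inj₂
    ( subst (λ a → a < 8 ℕ.+ t) (sym (cong (_∸ 1) (6+t+2≡8+t t))) (ℕP.n<1+n _)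
    , refl
    , subst (λ a → 9 ℕ.+ t < a) (sym (6+t+2+2≡10+t t)) (ℕP.n<1+n _)))))

hEdge-< : ∀ {t u v} → HEdge t u v → u < v
hEdge-< (spine _)  = ℕP.n<1+n _
hEdge-< leg₁       = s≤s (s≤s (s≤s z≤n))
hEdge-< foot₁      = ℕP.n<1+n _
hEdge-< {t} leg₂   = offset-< {3} {8} t _
hEdge-< foot₂      = ℕP.n<1+n _

hEdge-spine : ∀ {t a b} → b < 6 ℕ.+ t → HEdge t a b → suc a ≡ b
hEdge-spine     _  (spine _) = refl
hEdge-spine     b<r leg₁     = ⊥-elim (ℕP.n≮n _ b<r)
hEdge-spine {t} b<r foot₁    = ⊥-elim (offset-<⁻ 7 6 t b<r)
hEdge-spine {t} b<r leg₂     = ⊥-elim (offset-<⁻ 8 6 t b<r)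
hEdge-spine {t} b<r foot₂    = ⊥-elim (offset-<⁻ 9 6 t b<r)

hEdge-to-6+t : ∀ {t b} → HEdge t b (6 ℕ.+ t) → b ≡ 2
hEdge-to-6+t (spine r<r) = ⊥-elim (ℕP.n≮n _ r<r)
hEdge-to-6+t leg₁        = refl

hEdge-to-7+t : ∀ {t b} → HEdge t b (7 ℕ.+ t) → b ≡ 6 ℕ.+ t
hEdge-to-7+t {t} (spine h) = ⊥-elim (offset-<⁻ 7 6 t h)
hEdge-to-7+t foot₁         = refl

hEdge-to-8+t : ∀ {t b} → HEdge t b (8 ℕ.+ t) → b ≡ 3 ℕ.+ t
hEdge-to-8+t {t} (spine h) = ⊥-elim (offset-<⁻ 8 6 t h)
hEdge-to-8+t leg₂          = refl

hEdge-to-9+t : ∀ {t b} → HEdge t b (9 ℕ.+ t) → b ≡ 8 ℕ.+ t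
hEdge-to-9+t {t} (spine h) = ⊥-elim (offset-<⁻ 9 6 t h)
hEdge-to-9+t foot₂         = refl

hMatrix : ℕ → ℕ → ℕ → ℤ
hMatrix t = charMatrix₂ (hEdge t)

hMatrix-diag : ∀ t a → hMatrix t a a ≡ + 2
hMatrix-diag t a = charMatrix₂-diag (hEdge t) a (λ e → ℕP.n≮n a (hEdge-< (hEdge-sound e)))

hMatrix-edge : ∀ {t a b} → HEdge t a b → Adjacent (hMatrix t) a b
hMatrix-edge {t} {a} {b} e = charMatrix₂-edge (hEdge t) a b (ℕP.<⇒≢ (hEdge-< e)) (hEdge-complete e)

hMatrix-lowerNeighbour : ∀ t x ℓ → (∀ {b} → HEdge t b x → b ≡ ℓ) →
                         ∀ b → b < x → b ≢ ℓ → Nonadjacent (hMatrix t) x b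
hMatrix-lowerNeighbour t x ℓ unique b b<x b≢ℓ = charMatrix₂-nonedge (hEdge t) x b (ℕP.>⇒≢ b<x)
  (λ e → ℕP.<-asym b<x (hEdge-< (hEdge-sound e)))
  (λ e → b≢ℓ (unique (hEdge-sound e)))

hMatrix-spine : ∀ t a b → a < 6 ℕ.+ t → b < 6 ℕ.+ t → hMatrix t a b ≡ pathMatrix a b
hMatrix-spine t a b a<r b<r = charMatrix₂-cong (hEdge t) pathEdge a b (agree b<r) (agree a<r)
  where
  agree : ∀ {a b} → b < 6 ℕ.+ t → T (hEdge t a b) ⇔ T (pathEdge a b)
  agree b<r = mk⇔ (==⁺ ∘ hEdge-spine b<r ∘ hEdge-sound)
                      (λ e → hEdge-complete (subst (HEdge t _) (==⁻ e) (spine (subst (_< 6 ℕ.+ t) (sym (==⁻ e)) b<r))))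

-- Stated for a variable n: at n = 10 + t both sides would be compared by evaluating det.
charPolyAt-H : ∀ n → charPolyAt (H n) (+ 2) ≡ detOn (n ∸ 4 ℕ.+ 2 ℕ.+ 2) (charMatrix₂ (edgeP 2 2 (n ∸ 4) 2 (n ∸ 7)))
charPolyAt-H n = charPolyAt-P 2 2 (n ∸ 4) 2 (n ∸ 7)

hMatrix-detPath : ∀ t k φ → (∀ x → x < k → φ x < 6 ℕ.+ t) →
                  detOn k (λ a b → hMatrix t (φ a) (φ b)) ≡ detPath k φ
hMatrix-detPath t k φ φ<r = detOn-cong k (λ a b a<k b<k → hMatrix-spine t (φ a) (φ b) (φ<r a a<k) (φ<r b b<k))

punchInℕ-<-suc : ∀ p {x n} → x < n → punchInℕ p x < suc n
punchInℕ-<-suc p x<n = ℕP.≤-<-trans (punchInℕ-≤ p _) (s≤s x<n)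

detOn-H-pendant₂ : ∀ t → detOn (10 ℕ.+ t) (hMatrix t)
  ≡ + 3 * detOn (8 ℕ.+ t) (hMatrix t) - + 2 * detOn (7 ℕ.+ t) (removeVertex (3 ℕ.+ t) (hMatrix t))
detOn-H-pendant₂ t = detOn-pendantPath (7 ℕ.+ t) (hMatrix t) (3 ℕ.+ t) (+ 2) (offset-< {3} {8} t _)
  (hMatrix-diag t (9 ℕ.+ t)) (hMatrix-diag t (8 ℕ.+ t))
  (hMatrix-edge {t} foot₂) (hMatrix-edge {t} leg₂)
  (λ a a<8 → hMatrix-lowerNeighbour t (9 ℕ.+ t) (8 ℕ.+ t) hEdge-to-9+t a (ℕP.<-trans a<8 (ℕP.n<1+n _)) (ℕP.<⇒≢ a<8))
  (hMatrix-lowerNeighbour t (8 ℕ.+ t) (3 ℕ.+ t) hEdge-to-8+t)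

detOn-H-without-pendant₂ : ∀ t → detOn (8 ℕ.+ t) (hMatrix t) ≡ + 3 * + (7 ℕ.+ t) - + 2 * (+ 3 * + (4 ℕ.+ t))
detOn-H-without-pendant₂ t = begin
  detOn (8 ℕ.+ t) (hMatrix t)
    ≡⟨ detOn-pendantPath (5 ℕ.+ t) (hMatrix t) 2 (+ 2) (s≤s (s≤s (s≤s z≤n)))
         (hMatrix-diag t (7 ℕ.+ t)) (hMatrix-diag t (6 ℕ.+ t))
         (hMatrix-edge {t} foot₁) (hMatrix-edge {t} leg₁)
         (λ a a<6 → hMatrix-lowerNeighbour t (7 ℕ.+ t) (6 ℕ.+ t) hEdge-to-7+t a (ℕP.<-trans a<6 (ℕP.n<1+n _)) (ℕP.<⇒≢ a<6))
         (hMatrix-lowerNeighbour t (6 ℕ.+ t) 2 hEdge-to-6+t) ⟩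
  + 3 * detOn (6 ℕ.+ t) (hMatrix t) - + 2 * detOn (5 ℕ.+ t) (removeVertex 2 (hMatrix t))
    ≡⟨ cong₂ (λ d e → + 3 * d - + 2 * e)
             (hMatrix-detPath t (6 ℕ.+ t) (λ x → x) (λ _ x<r → x<r))
             (hMatrix-detPath t (5 ℕ.+ t) (punchInℕ 2) (λ _ → punchInℕ-<-suc 2)) ⟩
  + 3 * detPath (6 ℕ.+ t) (λ x → x) - + 2 * detPath (5 ℕ.+ t) (punchInℕ 2)
    ≡⟨ cong₂ (λ d e → + 3 * d - + 2 * e)
             (detPath-interval (5 ℕ.+ t) (λ x → x) ℕP.n<1+n (λ _ _ → refl))
             (detPath-punchIn 0 2 (2 ℕ.+ t)) ⟩
  + 3 * + (7 ℕ.+ t) - + 2 * (+ 3 * + (4 ℕ.+ t))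
    ∎
  where open ≡-Reasoning

detOn-H-without-pendant₂-and-3+t : ∀ t → detOn (7 ℕ.+ t) (removeVertex (3 ℕ.+ t) (hMatrix t))
  ≡ + 3 * (+ (4 ℕ.+ t) * + 3) - + 2 * (+ 3 * (+ (1 ℕ.+ t) * + 3))
detOn-H-without-pendant₂-and-3+t t = begin
  detOn (7 ℕ.+ t) G
    ≡⟨ detOn-pendantPath (4 ℕ.+ t) G 2 (+ 2) (s≤s (s≤s (s≤s z≤n)))
         (hMatrix-diag t (punchInℕ p (6 ℕ.+ t))) (hMatrix-diag t (punchInℕ p (5 ℕ.+ t)))
         (subst₂ (Adjacent (hMatrix t)) (sym p5) (sym p6) (hMatrix-edge {t} foot₁))
         (subst (Adjacent (hMatrix t) 2) (sym p5) (hMatrix-edge {t} leg₁))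
         (λ a a<5 → subst (λ x → Nonadjacent (hMatrix t) x (punchInℕ p a)) (sym p6)
            (hMatrix-lowerNeighbour t (7 ℕ.+ t) (6 ℕ.+ t) hEdge-to-7+t (punchInℕ p a)
               (ℕP.<-trans (bound a<5) (ℕP.n<1+n _)) (ℕP.<⇒≢ (bound a<5))))
         (λ a a<5 a≢2 → subst (λ x → Nonadjacent (hMatrix t) x (punchInℕ p a)) (sym p5)
            (hMatrix-lowerNeighbour t (6 ℕ.+ t) 2 hEdge-to-6+t (punchInℕ p a) (bound a<5)
               (a≢2 ∘ punchInℕ-injective p))) ⟩
  + 3 * detOn (5 ℕ.+ t) G - + 2 * detOn (4 ℕ.+ t) (removeVertex 2 G)
    ≡⟨ cong₂ (λ d e → + 3 * d - + 2 * e)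
             (hMatrix-detPath t (5 ℕ.+ t) (punchInℕ p) (λ _ → punchInℕ-<-suc p))
             (hMatrix-detPath t (4 ℕ.+ t) (punchInℕ p ∘ punchInℕ 2)
                (λ _ x<4 → punchInℕ-<-suc p (punchInℕ-<-suc 2 x<4))) ⟩
  + 3 * detPath (5 ℕ.+ t) (punchInℕ p) - + 2 * detPath (4 ℕ.+ t) (punchInℕ p ∘ punchInℕ 2)
    ≡⟨ cong₂ (λ d e → + 3 * d - + 2 * e) minusP minus2P ⟩
  + 3 * (+ (4 ℕ.+ t) * + 3) - + 2 * (+ 3 * (+ (1 ℕ.+ t) * + 3))
    ∎
  where
  open ≡-Reasoning
  p = 3 ℕ.+ t
  G = removeVertex p (hMatrix t)
  p6 : punchInℕ p (6 ℕ.+ t) ≡ 7 ℕ.+ t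
  p6 = punchInℕ-≥ (ℕP.+-monoˡ-≤ t (ℕP.≤ᵇ⇒≤ 3 6 _))
  p5 : punchInℕ p (5 ℕ.+ t) ≡ 6 ℕ.+ t
  p5 = punchInℕ-≥ (ℕP.+-monoˡ-≤ t (ℕP.≤ᵇ⇒≤ 3 5 _))
  bound : ∀ {a} → a < 5 ℕ.+ t → punchInℕ p a < 6 ℕ.+ t
  bound = punchInℕ-<-suc p
  minusP : detPath (5 ℕ.+ t) (punchInℕ p) ≡ + (4 ℕ.+ t) * + 3
  minusP = trans (cong (λ n → detPath n (punchInℕ p)) (cong (3 ℕ.+_) (ℕP.+-comm 2 t)))
                 (detPath-punchIn 0 p 1)
  -- φ 0, φ 1 = 0, 1 is followed by the gap at 2, and φ (2 + x) = 3 + punchInℕ t x.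
  minus2P : detPath (4 ℕ.+ t) (punchInℕ p ∘ punchInℕ 2) ≡ + 3 * (+ (1 ℕ.+ t) * + 3)
  minus2P = begin
    detPath (4 ℕ.+ t) (punchInℕ p ∘ punchInℕ 2)
      ≡⟨ detPath-block 1 (2 ℕ.+ t) (punchInℕ p ∘ punchInℕ 2)
           (Increasing-∘ (punchInℕ-increasing p) (punchInℕ-increasing 2))
           (λ { zero _ → refl ; (suc i) (s≤s ()) }) (inj₂ λ ()) ⟩
    + 3 * detPath (2 ℕ.+ t) (λ x → 3 ℕ.+ punchInℕ t x)
      ≡⟨ cong (λ n → + 3 * detPath n (λ x → 3 ℕ.+ punchInℕ t x)) (ℕP.+-comm 2 t) ⟩
    + 3 * detPath (t ℕ.+ 2) (λ x → 3 ℕ.+ punchInℕ t x)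
      ≡⟨ cong (+ 3 *_) (detPath-punchIn 3 t 1) ⟩
    + 3 * (+ (1 ℕ.+ t) * + 3)
      ∎

charPolyAt-H-10+t : ∀ t → charPolyAt (H (10 ℕ.+ t)) (+ 2) ≡ + 9 * (+ (10 ℕ.+ t) - + 15)
charPolyAt-H-10+t t = begin
  charPolyAt (H (10 ℕ.+ t)) (+ 2)
    ≡⟨ charPolyAt-H (10 ℕ.+ t) ⟩
  detOn (6 ℕ.+ t ℕ.+ 2 ℕ.+ 2) (hMatrix t)
    ≡⟨ cong (λ n → detOn n (hMatrix t)) (6+t+2+2≡10+t t) ⟩
  detOn (10 ℕ.+ t) (hMatrix t)
    ≡⟨ detOn-H-pendant₂ t ⟩
  + 3 * detOn (8 ℕ.+ t) (hMatrix t) - + 2 * detOn (7 ℕ.+ t) (removeVertex (3 ℕ.+ t) (hMatrix t))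
    ≡⟨ cong₂ (λ d e → + 3 * d - + 2 * e) (detOn-H-without-pendant₂ t) (detOn-H-without-pendant₂-and-3+t t) ⟩
  + 3 * (+ 3 * + (7 ℕ.+ t) - + 2 * (+ 3 * + (4 ℕ.+ t)))
    - + 2 * (+ 3 * (+ (4 ℕ.+ t) * + 3) - + 2 * (+ 3 * (+ (1 ℕ.+ t) * + 3)))
    ≡⟨ collect (+ t) ⟩
  + 9 * (+ (10 ℕ.+ t) - + 15)
    ∎
  where
  open ≡-Reasoning
  collect : ∀ T → + 3 * (+ 3 * (+ 7 + T) - + 2 * (+ 3 * (+ 4 + T)))
                  - + 2 * (+ 3 * ((+ 4 + T) * + 3) - + 2 * (+ 3 * ((+ 1 + T) * + 3)))
                ≡ + 9 * ((+ 10 + T) - + 15)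
  collect = solve-∀

lemma3p11 : (n : ℕ) → 10 ≤ n → charPolyAt (H n) (+ 2) ≡ (+ 9) * ((+ n) - (+ 15))
lemma3p11 n 10≤n =
  subst (λ n → charPolyAt (H n) (+ 2) ≡ + 9 * (+ n - + 15)) (ℕP.m+[n∸m]≡n 10≤n) (charPolyAt-H-10+t (n ∸ 10))
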